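{- Let $p$ be the partially ordered pattern of length $4$ on the labels $\{1,2,3,4\}$ whose only relations are $1>3$ and $1>4$ (label $2$ is incomparable to all others, and $3,4$ are incomparable). Let $a(n)$ be the number of $n$-permutations avoiding $p$. Then $a(0)=a(1)=1$, $a(2)=2$, and for $n\geq 3$, $a(n)=2(a(n-1)+a(n-2))$. Also, $$\sum_{n\geq 0}a(n)x^n=\frac{1-x-2x^2}{1-2x-2x^2}.$$
   Context: An $n$-permutation is a permutation $\pi=\pi_1\cdots\pi_n$ of $\{1,\dots,n\}$ written in one-line notation (for $n=0$ there is exactly one, the empty permutation). A partially ordered pattern (POP) $p$ of length $k$ is a partial order $<_P$ on the label set $\{1,\dots,k\}$. An occurrence of $p$ in $\pi$ is a subsequence $\pi_{i_1}\pi_{i_2}\cdots\pi_{i_k}$ with $1\leq i_1<\cdots<i_k\leq n$ such that $\pi_{i_j}<\pi_{i_m}$ whenever $j<_P m$ (no condition is imposed on pairs of incomparable labels). A permutation avoids $p$ if it contains no occurrence of $p$. -}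

module Defs where

open import Data.Nat as ℕ using (ℕ; zero; suc)
open import Data.Fin as F using (Fin; zero; suc; _<_)
open import Data.Fin.Properties using (_≟_; _<?_; any?; all?)
open import Data.Vec using (Vec; []; _∷_; lookup)
open import Data.List using (List; []; _∷_; concatMap; map; filter; length)
open import Data.Product using (Σ; _×_; _,_; ∃)
open import Data.Integer as ℤ using (ℤ)
open import Relation.Nullary using (¬_; Dec; yes; no)
open import Relation.Nullary.Decidable using (_×-dec_; ¬?; _→-dec_)
open import Relation.Binary.PropositionalEquality using (_≡_; _≢_)

-- n-permutations in one-line notation: π = π₁⋯πₙ is a vector of length n
-- of values in Fin n (value v encodes v+1) which is injective.

IsPerm : ∀ {n} → Vec (Fin n) n → Set
IsPerm {n} π = (i j : Fin n) → i ≢ j → lookup π i ≢ lookup π j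

isPerm? : ∀ {n} (π : Vec (Fin n) n) → Dec (IsPerm π)
isPerm? {n} π = all? λ i → all? λ j → ¬? (i ≟ j) →-dec ¬? (lookup π i ≟ lookup π j)

allVecs : (m k : ℕ) → List (Vec (Fin k) m)
allVecs zero    k = [] ∷ []
allVecs (suc m) k = concatMap (λ v → map (_∷ v) (allFinL k)) (allVecs m k)
  where
  allFinL : (k : ℕ) → List (Fin k)
  allFinL zero    = []
  allFinL (suc k) = zero ∷ map suc (allFinL k)

perms : (n : ℕ) → List (Vec (Fin n) n)
perms n = filter isPerm? (allVecs n n)

-- The POP p of length 4: labels 1,2,3,4 are encoded as Fin 4 = 0,1,2,3.
-- The only relations are 3 <_P 1 and 4 <_P 1.

data _<P_ : Fin 4 → Fin 4 → Set where
  3<P1 : suc (suc zero) <P zero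
  4<P1 : suc (suc (suc zero)) <P zero

idx : ∀ {n} → Fin n → Fin n → Fin n → Fin n → Fin 4 → Fin n
idx a b c d zero                   = a
idx a b c d (suc zero)             = b
idx a b c d (suc (suc zero))       = c
idx a b c d (suc (suc (suc zero))) = d

Occurrence : ∀ {n} → Vec (Fin n) n → Set
Occurrence {n} π =
  Σ (Fin n) λ i₁ → Σ (Fin n) λ i₂ → Σ (Fin n) λ i₃ → Σ (Fin n) λ i₄ →
    (i₁ < i₂ × i₂ < i₃ × i₃ < i₄) ×
    ((j m : Fin 4) → j <P m →
       lookup π (idx i₁ i₂ i₃ i₄ j) < lookup π (idx i₁ i₂ i₃ i₄ m))

Avoids : ∀ {n} → Vec (Fin n) n → Set
Avoids π = ¬ Occurrence π

private
  <P? : (j m : Fin 4) → Dec (j <P m)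
  <P? zero m = no λ ()
  <P? (suc zero) m = no λ ()
  <P? (suc (suc zero)) zero = yes 3<P1
  <P? (suc (suc zero)) (suc m) = no λ ()
  <P? (suc (suc (suc zero))) zero = yes 4<P1
  <P? (suc (suc (suc zero))) (suc m) = no λ ()

occurrence? : ∀ {n} (π : Vec (Fin n) n) → Dec (Occurrence π)
occurrence? {n} π =
  any? λ a → any? λ b → any? λ c → any? λ d →
    ((a <? b) ×-dec (b <? c) ×-dec (c <? d)) ×-dec
    (all? λ j → all? λ m → <P? j m →-dec (lookup π (idx a b c d j) <? lookup π (idx a b c d m)))

avoids? : ∀ {n} (π : Vec (Fin n) n) → Dec (Avoids π)
avoids? π = ¬? (occurrence? π)

a : ℕ → ℕ
a n = length (filter avoids? (perms n))

FPS : Set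
FPS = ℕ → ℤ

sumTo : ℕ → (ℕ → ℤ) → ℤ
sumTo zero    f = f zero
sumTo (suc n) f = sumTo n f ℤ.+ f (suc n)

_⊛_ : FPS → FPS → FPS
(f ⊛ g) n = sumTo n λ i → f i ℤ.* g (n ℕ.∸ i)

poly : List ℤ → FPS
poly []       n       = ℤ.0ℤ
poly (c ∷ cs) zero    = c
poly (c ∷ cs) (suc n) = poly cs n

genA : FPS
genA n = ℤ.+ (a n)

{-# OPTIONS --safe #-}
-- Write an (n+1)-permutation as π = v τ: first entry v, the rest order-isomorphic to τ.
-- An occurrence of p in π either lies inside τ or has label 1 at π's first entry; in the
-- latter case label 2 may as well sit at the second position, and labels 3 and 4 are two
-- later entries below v. So π avoids p iff τ does and at most one value below v comes
-- after the second position. For v = 1, 2 this is automatic; for v ≥ 4 it fails, since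
-- the second position holds at most one of the values 1, 2, 3; for v = 3 it says that the
-- second entry is 1 or 2, after which the cases v = 1, 2 applied to τ leave the last n - 1
-- entries free to form any avoider. Hence a(n+1) = a(n) + a(n) + 2 a(n-1), and multiplying
-- the series by 1 - 2x - 2x² leaves only the terms of degree at most 2.
module Submission where

open import Defs
open import Data.Nat using (ℕ; zero; suc; _+_; _*_; _∸_; z≤n; s≤s)
import Data.Nat as ℕ
import Data.Nat.Properties as ℕₚ
open import Data.Nat.ListAction using (sum)
open import Data.Nat.Tactic.RingSolver using (solve-∀)
open import Data.Integer as ℤ using (ℤ; +_; -_; 0ℤ)
import Data.Integer.Properties as ℤₚ
open import Data.Integer.Tactic.RingSolver renaming (solve-∀ to ℤ-solve-∀)
open import Data.Fin using (Fin; zero; suc; toℕ; punchIn; punchOut; _<_)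
open import Data.Fin.Properties
  using (_≟_; any?; pigeonhole; <-cmp; <⇒≢; ≤∧≢⇒<; suc-injective; punchIn-injective;
         punchInᵢ≢i; punchIn-mono-≤; punchIn-punchOut; punchOut-injective)
open import Data.Vec using (Vec; []; _∷_; lookup; head)
import Data.Vec as Vec
open import Data.Vec.Properties
  using (∷-injective; ∷-injectiveˡ; ∷-injectiveʳ; lookup-map; lookup∘tabulate;
         tabulate∘lookup; tabulate-∘; tabulate-cong)
open import Data.List
  using (List; []; _∷_; _++_; map; filter; length; concatMap; cartesianProductWith; allFin;
         tabulate)
open import Data.List.Properties
  using (filter-++; length-++; filter-accept; filter-reject; filter-none; map-injective;
         map-tabulate; ++-identityʳ)
open import Data.List.Membership.Propositional using (_∈_)
open import Data.List.Membership.Propositional.Properties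
  using (∈-filter⁺; ∈-filter⁻; ∈-allFin; ∈-cartesianProductWith⁺; ∈-cartesianProductWith⁻)
open import Data.List.Membership.Propositional.Properties.WithK using (unique∧set⇒bag)
open import Data.List.Relation.Unary.Any using (here; there)
import Data.List.Relation.Unary.All as All
import Data.List.Relation.Unary.AllPairs.Core as AllPairs
open import Data.List.Relation.Unary.Unique.Propositional using (Unique)
open import Data.List.Relation.Unary.Unique.Propositional.Properties
  using (cartesianProductWith⁺; allFin⁺; filter⁺)
open import Data.List.Relation.Binary.Permutation.Propositional using (_↭_)
open import Data.List.Relation.Binary.Permutation.Propositional.Properties
  using (↭-length; filter-↭)
open import Data.List.Relation.Binary.BagAndSetEquality using (∼bag⇒↭)
open import Data.Product using (Σ; ∃; ∃₂; _×_; _,_; proj₂)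
open import Data.Sum using (_⊎_; inj₁; inj₂; [_,_]′)
open import Data.Empty using (⊥; ⊥-elim)
open import Function using (_∘_; _⇔_; mk⇔; Equivalence)
open import Function.Construct.Composition using (_⇔-∘_)
open import Level using (0ℓ)
open import Relation.Nullary using (¬_; yes; no)
open import Relation.Unary using (Pred; Decidable)
open import Relation.Binary.Definitions using (tri<; tri≈; tri>)
open import Relation.Binary.PropositionalEquality

module _ {A B C : Set} (f : A → B → C) where

  concatMap-map≡cartesianProductWith : ∀ xs ys →
    concatMap (λ x → map (f x) ys) xs ≡ cartesianProductWith f xs ys
  concatMap-map≡cartesianProductWith []       ys = refl
  concatMap-map≡cartesianProductWith (x ∷ xs) ys =
    cong (map (f x) ys ++_) (concatMap-map≡cartesianProductWith xs ys)

module _ {A : Set} {P Q : Pred A 0ℓ} (P? : Decidable P) (Q? : Decidable Q) where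

  filter-cong-∈ : ∀ {xs} → (∀ {x} → x ∈ xs → P x ⇔ Q x) → filter P? xs ≡ filter Q? xs
  filter-cong-∈ {[]}     P⇔Q = refl
  filter-cong-∈ {x ∷ xs} P⇔Q with P? x
  ... | yes Px = trans (cong (x ∷_) (filter-cong-∈ (P⇔Q ∘ there)))
                       (sym (filter-accept Q? (Equivalence.to (P⇔Q (here refl)) Px)))
  ... | no ¬Px = trans (filter-cong-∈ (P⇔Q ∘ there))
                       (sym (filter-reject Q? (¬Px ∘ Equivalence.from (P⇔Q (here refl)))))

module _ {A : Set} {P : Pred A 0ℓ} (P? : Decidable P) where

  length-filter-none-∈ : ∀ {xs} → (∀ {x} → x ∈ xs → ¬ P x) → length (filter P? xs) ≡ 0
  length-filter-none-∈ ¬P = cong length (filter-none P? (All.tabulate ¬P))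

  length-filter-map : ∀ {B : Set} (f : B → A) xs →
    length (filter P? (map f xs)) ≡ length (filter (P? ∘ f) xs)
  length-filter-map f []       = refl
  length-filter-map f (x ∷ xs) with P? (f x)
  ... | yes _ = cong suc (length-filter-map f xs)
  ... | no  _ = length-filter-map f xs

  length-filter-cartesianProductWith : ∀ {B C : Set} (f : B → C → A) xs ys →
    length (filter P? (cartesianProductWith f xs ys))
      ≡ sum (map (λ x → length (filter (P? ∘ f x) ys)) xs)
  length-filter-cartesianProductWith f []       ys = refl
  length-filter-cartesianProductWith f (x ∷ xs) ys = begin
    length (filter P? (map (f x) ys ++ cartesianProductWith f xs ys))
      ≡⟨ cong length (filter-++ P? (map (f x) ys) _) ⟩
    length (filter P? (map (f x) ys) ++ filter P? (cartesianProductWith f xs ys))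
      ≡⟨ length-++ (filter P? (map (f x) ys)) ⟩
    length (filter P? (map (f x) ys)) + length (filter P? (cartesianProductWith f xs ys))
      ≡⟨ cong₂ _+_ (length-filter-map (f x) ys) (length-filter-cartesianProductWith f xs ys) ⟩
    length (filter (P? ∘ f x) ys) + sum (map (λ x → length (filter (P? ∘ f x) ys)) xs)
      ∎
    where open ≡-Reasoning

sum-map-tabulate-≡0 : ∀ {A : Set} {n} (g : A → ℕ) (h : Fin n → A) →
  (∀ i → g (h i) ≡ 0) → sum (map g (tabulate h)) ≡ 0
sum-map-tabulate-≡0 {n = zero}  g h g∘h≡0 = refl
sum-map-tabulate-≡0 {n = suc n} g h g∘h≡0 =
  cong₂ _+_ (g∘h≡0 zero) (sum-map-tabulate-≡0 g (h ∘ suc) (g∘h≡0 ∘ suc))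

digits-injective : ∀ {k} {L L′ : List (Fin k)} →
  map Vec.[_] L ++ [] ≡ map Vec.[_] L′ ++ [] → L ≡ L′
digits-injective {L = L} {L′} eq = map-injective ∷-injectiveˡ
  (trans (sym (++-identityʳ (map Vec.[_] L))) (trans eq (++-identityʳ (map Vec.[_] L′))))

-- allVecs draws its digits from a local copy of allFin, reachable only through allVecs 1
allVecs-one : ∀ k → allVecs 1 k ≡ map Vec.[_] (allFin k) ++ []
allVecs-one zero    = refl
allVecs-one (suc k) = extend (allVecs-one k)
  where
  extend : {L : List (Fin k)} → map Vec.[_] L ++ [] ≡ map Vec.[_] (allFin k) ++ [] →
           map Vec.[_] (zero ∷ map suc L) ++ [] ≡ map Vec.[_] (allFin (suc k)) ++ []
  extend eq rewrite digits-injective eq =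
    cong (λ L → map Vec.[_] (zero ∷ L) ++ []) (map-tabulate (λ i → i) suc)

allVecs-suc : ∀ m k →
  allVecs (suc m) k ≡ cartesianProductWith (λ v i → i ∷ v) (allVecs m k) (allFin k)
allVecs-suc m k = trans
  (cong (λ L → concatMap (λ v → map (_∷ v) L) (allVecs m k)) (digits-injective (allVecs-one k)))
  (concatMap-map≡cartesianProductWith (λ v i → i ∷ v) (allVecs m k) (allFin k))

allVecs-unique : ∀ m k → Unique (allVecs m k)
allVecs-unique zero    k = All.[] AllPairs.∷ AllPairs.[]
allVecs-unique (suc m) k = subst Unique (sym (allVecs-suc m k))
  (cartesianProductWith⁺ _ (λ eq → ∷-injectiveʳ eq , ∷-injectiveˡ eq)
    (allVecs-unique m k) (allFin⁺ k))

∈-allVecs : ∀ {m k} (v : Vec (Fin k) m) → v ∈ allVecs m k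
∈-allVecs []                  = here refl
∈-allVecs {suc m} {k} (i ∷ v) = subst (i ∷ v ∈_) (sym (allVecs-suc m k))
  (∈-cartesianProductWith⁺ (λ v i → i ∷ v) (∈-allVecs v) (∈-allFin i))

perms-unique : ∀ n → Unique (perms n)
perms-unique n = filter⁺ isPerm? (allVecs-unique n n)

∈-perms⁺ : ∀ {n} {π : Vec (Fin n) n} → IsPerm π → π ∈ perms n
∈-perms⁺ {n} {π} = ∈-filter⁺ isPerm? (∈-allVecs π)

∈-perms⁻ : ∀ {n} {π : Vec (Fin n) n} → π ∈ perms n → IsPerm π
∈-perms⁻ {n} = proj₂ ∘ ∈-filter⁻ isPerm? {xs = allVecs n n}

lookup-surjective : ∀ {n} (π : Vec (Fin n) n) → IsPerm π → ∀ y → ∃ λ i → lookup π i ≡ y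
lookup-surjective {suc n} π π-perm y with any? (λ i → lookup π i ≟ y)
... | yes hit = hit
... | no miss = ⊥-elim (collision (pigeonhole (ℕₚ.n<1+n n) (punchOut ∘ y≢π)))
  where
  y≢π : ∀ i → y ≢ lookup π i
  y≢π i y≡πi = miss (i , sym y≡πi)
  collision : ¬ ∃₂ λ i j → i < j × punchOut (y≢π i) ≡ punchOut (y≢π j)
  collision (i , j , i<j , eq) =
    π-perm i j (<⇒≢ i<j) (punchOut-injective (y≢π i) (y≢π j) eq)

prepend : ∀ {m} → Fin (suc m) → Vec (Fin m) m → Vec (Fin (suc m)) (suc m)
prepend v τ = v ∷ Vec.map (punchIn v) τ

lookup-prepend : ∀ {m} (v : Fin (suc m)) (τ : Vec (Fin m) m) i →
  lookup (prepend v τ) (suc i) ≡ punchIn v (lookup τ i)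
lookup-prepend v τ i = lookup-map i (punchIn v) τ

prepend-isPerm : ∀ {m} (v : Fin (suc m)) (τ : Vec (Fin m) m) → IsPerm τ → IsPerm (prepend v τ)
prepend-isPerm v τ τ-perm zero    zero    0≢0 _  = 0≢0 refl
prepend-isPerm v τ τ-perm zero    (suc j) _   eq =
  punchInᵢ≢i v (lookup τ j) (sym (trans eq (lookup-prepend v τ j)))
prepend-isPerm v τ τ-perm (suc i) zero    _   eq =
  punchInᵢ≢i v (lookup τ i) (trans (sym (lookup-prepend v τ i)) eq)
prepend-isPerm v τ τ-perm (suc i) (suc j) i≢j eq =
  τ-perm i j (i≢j ∘ cong suc) (punchIn-injective v _ _
    (trans (sym (lookup-prepend v τ i)) (trans eq (lookup-prepend v τ j))))

prepend-injective : ∀ {m} {v w : Fin (suc m)} {τ σ : Vec (Fin m) m} →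
  prepend v τ ≡ prepend w σ → v ≡ w × τ ≡ σ
prepend-injective {v = v} eq with ∷-injective eq
... | refl , tails = refl , map-punchIn-injective tails
  where
  map-punchIn-injective : ∀ {k} {τ σ : Vec _ k} →
    Vec.map (punchIn v) τ ≡ Vec.map (punchIn v) σ → τ ≡ σ
  map-punchIn-injective {τ = []}    {[]}    _  = refl
  map-punchIn-injective {τ = x ∷ τ} {y ∷ σ} eq with ∷-injective eq
  ... | x≡y , τ≡σ = cong₂ _∷_ (punchIn-injective v x y x≡y) (map-punchIn-injective τ≡σ)

isPerm⇒prepend : ∀ {m} {π : Vec (Fin (suc m)) (suc m)} → IsPerm π →
  ∃ λ τ → IsPerm τ × π ≡ prepend (head π) τ
isPerm⇒prepend {m} {v ∷ t} π-perm = τ , τ-perm , cong (v ∷_) (sym map-punchIn-τ)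
  where
  v≢t : ∀ j → v ≢ lookup t j
  v≢t j = π-perm zero (suc j) (λ ())
  τ : Vec (Fin m) m
  τ = Vec.tabulate (punchOut ∘ v≢t)
  map-punchIn-τ : Vec.map (punchIn v) τ ≡ t
  map-punchIn-τ = begin
    Vec.map (punchIn v) τ                      ≡⟨ tabulate-∘ (punchIn v) (punchOut ∘ v≢t) ⟨
    Vec.tabulate (punchIn v ∘ punchOut ∘ v≢t)  ≡⟨ tabulate-cong (punchIn-punchOut ∘ v≢t) ⟩
    Vec.tabulate (lookup t)                    ≡⟨ tabulate∘lookup t ⟩
    t                                          ∎
    where open ≡-Reasoning
  lookup-τ : ∀ i → lookup τ i ≡ punchOut (v≢t i)
  lookup-τ = lookup∘tabulate (punchOut ∘ v≢t)
  τ-perm : IsPerm τ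
  τ-perm i j i≢j eq = π-perm (suc i) (suc j) (i≢j ∘ suc-injective)
    (punchOut-injective (v≢t i) (v≢t j) (trans (sym (lookup-τ i)) (trans eq (lookup-τ j))))

perms-suc-↭ : ∀ m → perms (suc m) ↭ cartesianProductWith prepend (allFin (suc m)) (perms m)
perms-suc-↭ m = ∼bag⇒↭ (unique∧set⇒bag (perms-unique (suc m))
  (cartesianProductWith⁺ prepend prepend-injective (allFin⁺ (suc m)) (perms-unique m))
  (mk⇔ to from))
  where
  to : ∀ {π} → π ∈ perms (suc m) → π ∈ cartesianProductWith prepend (allFin (suc m)) (perms m)
  to π∈ with isPerm⇒prepend (∈-perms⁻ π∈)
  ... | τ , τ-perm , π≡ = subst (_∈ _) (sym π≡)
    (∈-cartesianProductWith⁺ prepend (∈-allFin _) (∈-perms⁺ τ-perm))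
  from : ∀ {π} → π ∈ cartesianProductWith prepend (allFin (suc m)) (perms m) → π ∈ perms (suc m)
  from π∈ with ∈-cartesianProductWith⁻ prepend (allFin (suc m)) (perms m) π∈
  ... | v , τ , _ , τ∈ , refl = ∈-perms⁺ (prepend-isPerm v τ (∈-perms⁻ τ∈))

length-filter-perms-suc : ∀ {m} {P : Pred (Vec (Fin (suc m)) (suc m)) 0ℓ} (P? : Decidable P) →
  length (filter P? (perms (suc m)))
    ≡ sum (map (λ v → length (filter (P? ∘ prepend v) (perms m))) (allFin (suc m)))
length-filter-perms-suc {m} P? = trans (↭-length (filter-↭ P? (perms-suc-↭ m)))
  (length-filter-cartesianProductWith P? prepend (allFin (suc m)) (perms m))

punchIn-mono-< : ∀ {m} (v : Fin (suc m)) {x y : Fin m} → x < y → punchIn v x < punchIn v y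
punchIn-mono-< v {x} {y} x<y =
  ≤∧≢⇒< (punchIn-mono-≤ v x y (ℕₚ.<⇒≤ x<y)) (<⇒≢ x<y ∘ punchIn-injective v x y)

punchIn-cancel-< : ∀ {m} (v : Fin (suc m)) {x y : Fin m} → punchIn v x < punchIn v y → x < y
punchIn-cancel-< v {x} {y} h = ℕₚ.≰⇒> (ℕₚ.<⇒≱ h ∘ punchIn-mono-≤ v y x)

occurrence : ∀ {n} (π : Vec (Fin n) n) {i₁ i₂ i₃ i₄ : Fin n} → i₁ < i₂ → i₂ < i₃ → i₃ < i₄ →
  lookup π i₃ < lookup π i₁ → lookup π i₄ < lookup π i₁ → Occurrence π
occurrence π {i₁} {i₂} {i₃} {i₄} i₁<i₂ i₂<i₃ i₃<i₄ π₃<π₁ π₄<π₁ =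
  i₁ , i₂ , i₃ , i₄ , (i₁<i₂ , i₂<i₃ , i₃<i₄) , respects
  where
  respects : ∀ j m → j <P m → lookup π (idx i₁ i₂ i₃ i₄ j) < lookup π (idx i₁ i₂ i₃ i₄ m)
  respects _ _ 3<P1 = π₃<π₁
  respects _ _ 4<P1 = π₄<π₁

-- An occurrence with labels 1 and 2 at the first two positions; labels 3 and 4 sit at
-- the distinct positions 2+p and 2+q, in whichever order.
HeadOccurrence : ∀ {k} → Vec (Fin (suc (suc k))) (suc (suc k)) → Set
HeadOccurrence {k} π = Σ (Fin k) λ p → Σ (Fin k) λ q →
  p ≢ q × lookup π (suc (suc p)) < lookup π zero × lookup π (suc (suc q)) < lookup π zero

headOccurrence⇒occurrence : ∀ {k} (π : Vec (Fin (suc (suc k))) (suc (suc k))) →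
  HeadOccurrence π → Occurrence π
headOccurrence⇒occurrence π (p , q , p≢q , πp<π₀ , πq<π₀) with <-cmp p q
... | tri< p<q _ _ = occurrence π (s≤s z≤n) (s≤s (s≤s z≤n)) (s≤s (s≤s p<q)) πp<π₀ πq<π₀
... | tri≈ _ p≡q _ = ⊥-elim (p≢q p≡q)
... | tri> _ _ q<p = occurrence π (s≤s z≤n) (s≤s (s≤s z≤n)) (s≤s (s≤s q<p)) πq<π₀ πp<π₀

headOccurrence⇒¬avoids : ∀ {k} (π : Vec (Fin (suc (suc k))) (suc (suc k))) →
  HeadOccurrence π → ¬ Avoids π
headOccurrence⇒¬avoids π head avoids = avoids (headOccurrence⇒occurrence π head)

module _ {m : ℕ} (v : Fin (suc m)) (τ : Vec (Fin m) m) where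

  prepend-<⁺ : ∀ {i j} → lookup τ i < lookup τ j →
    lookup (prepend v τ) (suc i) < lookup (prepend v τ) (suc j)
  prepend-<⁺ {i} {j} h = subst₂ _<_ (sym (lookup-prepend v τ i)) (sym (lookup-prepend v τ j))
    (punchIn-mono-< v h)

  prepend-<⁻ : ∀ {i j} → lookup (prepend v τ) (suc i) < lookup (prepend v τ) (suc j) →
    lookup τ i < lookup τ j
  prepend-<⁻ {i} {j} h =
    punchIn-cancel-< v (subst₂ _<_ (lookup-prepend v τ i) (lookup-prepend v τ j) h)

  occurrence-prepend⁺ : Occurrence τ → Occurrence (prepend v τ)
  occurrence-prepend⁺ (_ , _ , _ , _ , (i₁<i₂ , i₂<i₃ , i₃<i₄) , f) =
    occurrence (prepend v τ) (s≤s i₁<i₂) (s≤s i₂<i₃) (s≤s i₃<i₄)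
      (prepend-<⁺ (f _ _ 3<P1)) (prepend-<⁺ (f _ _ 4<P1))

module _ {k : ℕ} {v : Fin (suc (suc k))} {τ : Vec (Fin (suc k)) (suc k)} where

  occurrence-prepend⁻ : Occurrence (prepend v τ) → Occurrence τ ⊎ HeadOccurrence (prepend v τ)
  occurrence-prepend⁻ (zero , zero , _ , _ , (() , _ , _) , _)
  occurrence-prepend⁻ (zero , suc _ , zero , _ , (_ , () , _) , _)
  occurrence-prepend⁻ (zero , suc _ , suc zero , _ , (_ , s≤s () , _) , _)
  occurrence-prepend⁻ (zero , suc _ , suc (suc _) , zero , (_ , _ , ()) , _)
  occurrence-prepend⁻ (zero , suc _ , suc (suc _) , suc zero , (_ , _ , s≤s ()) , _)
  occurrence-prepend⁻ (zero , suc _ , suc (suc p) , suc (suc q) , (_ , _ , s≤s (s≤s p<q)) , f) =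
    inj₂ (p , q , <⇒≢ p<q , f _ _ 3<P1 , f _ _ 4<P1)
  occurrence-prepend⁻ (suc _ , zero , _ , _ , (() , _ , _) , _)
  occurrence-prepend⁻ (suc _ , suc _ , zero , _ , (_ , () , _) , _)
  occurrence-prepend⁻ (suc _ , suc _ , suc _ , zero , (_ , _ , ()) , _)
  occurrence-prepend⁻ (suc _ , suc _ , suc _ , suc _ , (s≤s i₁<i₂ , s≤s i₂<i₃ , s≤s i₃<i₄) , f) =
    inj₁ (occurrence τ i₁<i₂ i₂<i₃ i₃<i₄
      (prepend-<⁻ v τ (f _ _ 3<P1)) (prepend-<⁻ v τ (f _ _ 4<P1)))

  avoids-prepend : ¬ HeadOccurrence (prepend v τ) → Avoids (prepend v τ) ⇔ Avoids τ
  avoids-prepend ¬head =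
    mk⇔ (_∘ occurrence-prepend⁺ v τ) (λ avoids → [ avoids , ¬head ]′ ∘ occurrence-prepend⁻)

headOccurrence-below : ∀ {k} (π : Vec (Fin (suc (suc k))) (suc (suc k))) → IsPerm π →
  ∀ {x y : Fin (suc (suc k))} → x ≢ y → x < lookup π zero → y < lookup π zero →
  x ≢ lookup π (suc zero) → y ≢ lookup π (suc zero) → HeadOccurrence π
headOccurrence-below π π-perm {x} {y} x≢y x<π₀ y<π₀ x≢π₁ y≢π₁
  with lookup-surjective π π-perm x | lookup-surjective π π-perm y
... | zero , π₀≡x | _ = ⊥-elim (<⇒≢ x<π₀ (sym π₀≡x))
... | suc zero , π₁≡x | _ = ⊥-elim (x≢π₁ (sym π₁≡x))
... | suc (suc _) , _ | zero , π₀≡y = ⊥-elim (<⇒≢ y<π₀ (sym π₀≡y))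
... | suc (suc _) , _ | suc zero , π₁≡y = ⊥-elim (y≢π₁ (sym π₁≡y))
... | suc (suc p) , πp≡x | suc (suc q) , πq≡y =
  p , q , x≢y ∘ positions-agree , subst (_< _) (sym πp≡x) x<π₀ , subst (_< _) (sym πq≡y) y<π₀
  where
  positions-agree : p ≡ q → x ≡ y
  positions-agree refl = trans (sym πp≡x) πq≡y

below-one : ∀ {n} {x : Fin (suc n)} → toℕ x ℕ.< 1 → x ≡ zero
below-one {x = zero}  _        = refl
below-one {x = suc _} (s≤s ())

below-two : ∀ {n} {x : Fin (suc (suc n))} → toℕ x ℕ.< 2 → x ≡ zero ⊎ x ≡ suc zero
below-two {x = zero}        _ = inj₁ refl
below-two {x = suc zero}    _ = inj₂ refl
below-two {x = suc (suc _)} (s≤s (s≤s ()))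

no-three-below-two : ∀ {n} {x y z : Fin (suc (suc n))} →
  toℕ x ℕ.< 2 → toℕ y ℕ.< 2 → toℕ z ℕ.< 2 → x ≢ y → x ≢ z → y ≢ z → ⊥
no-three-below-two x<2 y<2 z<2 x≢y x≢z y≢z
  with below-two x<2 | below-two y<2 | below-two z<2
... | inj₁ refl | inj₁ refl | _         = x≢y refl
... | inj₂ refl | inj₂ refl | _         = x≢y refl
... | inj₁ refl | inj₂ refl | inj₁ refl = x≢z refl
... | inj₁ refl | inj₂ refl | inj₂ refl = y≢z refl
... | inj₂ refl | inj₁ refl | inj₁ refl = y≢z refl
... | inj₂ refl | inj₁ refl | inj₂ refl = x≢z refl

two-values-below-three-≢ : ∀ {n} (z : Fin (suc (suc (suc n)))) →
  ∃₂ λ x y → x ≢ y × toℕ x ℕ.< 3 × toℕ y ℕ.< 3 × x ≢ z × y ≢ z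
two-values-below-three-≢ zero =
  suc zero , suc (suc zero) , (λ ()) , s≤s (s≤s z≤n) , s≤s (s≤s (s≤s z≤n)) , (λ ()) , (λ ())
two-values-below-three-≢ (suc zero) =
  zero , suc (suc zero) , (λ ()) , s≤s z≤n , s≤s (s≤s (s≤s z≤n)) , (λ ()) , (λ ())
two-values-below-three-≢ (suc (suc _)) =
  zero , suc zero , (λ ()) , s≤s z≤n , s≤s (s≤s z≤n) , (λ ()) , (λ ())

module _ {k : ℕ} where

  ¬headOccurrence-zero : (τ : Vec (Fin (suc k)) (suc k)) → ¬ HeadOccurrence (prepend zero τ)
  ¬headOccurrence-zero τ (_ , _ , _ , () , _)

  ¬headOccurrence-one : (τ : Vec (Fin (suc k)) (suc k)) → IsPerm τ →
    ¬ HeadOccurrence (prepend (suc zero) τ)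
  ¬headOccurrence-one τ τ-perm (p , q , p≢q , πp<1 , πq<1) =
    prepend-isPerm (suc zero) τ τ-perm (suc (suc p)) (suc (suc q))
      (p≢q ∘ suc-injective ∘ suc-injective) (trans (below-one πp<1) (sym (below-one πq<1)))

  avoids-prepend-low : ∀ {w : Fin (suc (suc k))} (σ : Vec (Fin (suc k)) (suc k)) →
    toℕ w ℕ.< 2 → IsPerm σ → Avoids (prepend w σ) ⇔ Avoids σ
  avoids-prepend-low σ w<2 σ-perm with below-two w<2
  ... | inj₁ refl = avoids-prepend (¬headOccurrence-zero σ)
  ... | inj₂ refl = avoids-prepend (¬headOccurrence-one σ σ-perm)

  ¬headOccurrence-two : (w : Fin (suc (suc k))) (σ : Vec (Fin (suc k)) (suc k)) →
    toℕ w ℕ.< 2 → IsPerm σ → ¬ HeadOccurrence (prepend (suc (suc zero)) (prepend w σ))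
  ¬headOccurrence-two w σ w<2 σ-perm (p , q , p≢q , πp<2 , πq<2) =
    no-three-below-two (π₁<2 w w<2) πp<2 πq<2
      (π-perm (suc zero) (suc (suc p)) (λ ())) (π-perm (suc zero) (suc (suc q)) (λ ()))
      (π-perm (suc (suc p)) (suc (suc q)) (p≢q ∘ suc-injective ∘ suc-injective))
    where
    π-perm : IsPerm (prepend (suc (suc zero)) (prepend w σ))
    π-perm = prepend-isPerm (suc (suc zero)) (prepend w σ) (prepend-isPerm w σ σ-perm)
    π₁<2 : ∀ w → toℕ w ℕ.< 2 → toℕ (punchIn (suc (suc zero)) w) ℕ.< 2
    π₁<2 zero          _ = s≤s z≤n
    π₁<2 (suc zero)    _ = s≤s (s≤s z≤n)
    π₁<2 (suc (suc _)) (s≤s (s≤s ()))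

  headOccurrence-two : (w : Fin k) (σ : Vec (Fin (suc k)) (suc k)) → IsPerm σ →
    HeadOccurrence (prepend (suc (suc zero)) (prepend (suc (suc w)) σ))
  headOccurrence-two w σ σ-perm = headOccurrence-below (prepend (suc (suc zero)) τ)
    (prepend-isPerm (suc (suc zero)) τ (prepend-isPerm (suc (suc w)) σ σ-perm))
    {zero} {suc zero} (λ ()) (s≤s z≤n) (s≤s (s≤s z≤n)) (λ ()) (λ ())
    where τ = prepend (suc (suc w)) σ

  headOccurrence-three : (v : Fin k) (τ : Vec (Fin (suc (suc k))) (suc (suc k))) → IsPerm τ →
    HeadOccurrence (prepend (suc (suc (suc v))) τ)
  headOccurrence-three v τ τ-perm
    with two-values-below-three-≢ (lookup (prepend (suc (suc (suc v))) τ) (suc zero))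
  ... | x , y , x≢y , x<3 , y<3 , x≢π₁ , y≢π₁ =
    headOccurrence-below (prepend (suc (suc (suc v))) τ)
      (prepend-isPerm (suc (suc (suc v))) τ τ-perm)
      x≢y (below-head x<3) (below-head y<3) x≢π₁ y≢π₁
    where
    below-head : ∀ {x} → toℕ x ℕ.< 3 → toℕ x ℕ.< toℕ (suc (suc (suc v)))
    below-head x<3 = ℕₚ.<-≤-trans x<3 (s≤s (s≤s (s≤s z≤n)))

-- Opaque so that conversion checking never unfolds the decision procedure avoids?.
opaque
  countAvoiding : ∀ {m n} → (Vec (Fin m) m → Vec (Fin n) n) → ℕ
  countAvoiding {m} f = length (filter (λ τ → avoids? (f τ)) (perms m))

opaque
  unfolding countAvoiding

  a≡countAvoiding-id : ∀ m → a m ≡ countAvoiding {m} (λ τ → τ)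
  a≡countAvoiding-id m = refl

  countAvoiding-prepend : ∀ {m n} (f : Vec (Fin (suc m)) (suc m) → Vec (Fin n) n) →
    countAvoiding f ≡ sum (map (λ v → countAvoiding (f ∘ prepend v)) (allFin (suc m)))
  countAvoiding-prepend f = length-filter-perms-suc (λ π → avoids? (f π))

  countAvoiding-≡a : ∀ {m n} (f : Vec (Fin m) m → Vec (Fin n) n) →
    (∀ {τ} → τ ∈ perms m → Avoids (f τ) ⇔ Avoids τ) → countAvoiding f ≡ a m
  countAvoiding-≡a f equiv = cong length (filter-cong-∈ (λ τ → avoids? (f τ)) avoids? equiv)

  countAvoiding-≡0 : ∀ {m n} (f : Vec (Fin m) m → Vec (Fin n) n) →
    (∀ {τ} → τ ∈ perms m → ¬ Avoids (f τ)) → countAvoiding f ≡ 0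
  countAvoiding-≡0 f = length-filter-none-∈ (λ τ → avoids? (f τ))

countAvoiding-prepend-low : ∀ k {w : Fin (suc (suc k))} → toℕ w ℕ.< 2 →
  countAvoiding (prepend w) ≡ a (suc k)
countAvoiding-prepend-low k {w} w<2 =
  countAvoiding-≡a (prepend w) (λ {σ} → avoids-prepend-low σ w<2 ∘ ∈-perms⁻)

countAvoiding-prepend-two : ∀ k →
  countAvoiding (prepend {suc (suc k)} (suc (suc zero))) ≡ a (suc k) + a (suc k)
countAvoiding-prepend-two k = begin
  countAvoiding (prepend two)
    ≡⟨ countAvoiding-prepend (prepend two) ⟩
  count zero + (count (suc zero) + sum (map count (tabulate (λ w → suc (suc w)))))
    ≡⟨ cong₂ _+_ (count-low (s≤s z≤n)) (cong₂ _+_ (count-low (s≤s (s≤s z≤n)))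
         (sum-map-tabulate-≡0 count (λ w → suc (suc w)) count-high)) ⟩
  a (suc k) + (a (suc k) + 0)
    ≡⟨ cong (λ x → a (suc k) + x) (ℕₚ.+-identityʳ (a (suc k))) ⟩
  a (suc k) + a (suc k)
    ∎
  where
  open ≡-Reasoning
  two : Fin (suc (suc (suc k)))
  two = suc (suc zero)
  count : Fin (suc (suc k)) → ℕ
  count w = countAvoiding (prepend two ∘ prepend w)
  count-low : ∀ {w} → toℕ w ℕ.< 2 → count w ≡ a (suc k)
  count-low {w} w<2 = countAvoiding-≡a (prepend two ∘ prepend w) λ {σ} σ∈ →
    let σ-perm = ∈-perms⁻ σ∈ in
    avoids-prepend-low σ w<2 σ-perm
      ⇔-∘ avoids-prepend {v = two} {τ = prepend w σ} (¬headOccurrence-two w σ w<2 σ-perm)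
  count-high : ∀ w → count (suc (suc w)) ≡ 0
  count-high w = countAvoiding-≡0 (prepend two ∘ prepend (suc (suc w))) λ {σ} →
    headOccurrence⇒¬avoids (prepend two (prepend (suc (suc w)) σ))
      ∘ headOccurrence-two w σ ∘ ∈-perms⁻

countAvoiding-prepend-three : ∀ k (v : Fin k) →
  countAvoiding (prepend {suc (suc k)} (suc (suc (suc v)))) ≡ 0
countAvoiding-prepend-three k v = countAvoiding-≡0 (prepend (suc (suc (suc v)))) λ {τ} →
  headOccurrence⇒¬avoids (prepend (suc (suc (suc v))) τ) ∘ headOccurrence-three v τ ∘ ∈-perms⁻

a-recurrence : ∀ n → a (suc (suc (suc n))) ≡ 2 * (a (suc (suc n)) + a (suc n))
a-recurrence n = begin
  a (suc (suc (suc n)))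
    ≡⟨ a≡countAvoiding-id (suc (suc (suc n))) ⟩
  countAvoiding (λ π → π)
    ≡⟨ countAvoiding-prepend (λ π → π) ⟩
  withHead zero + (withHead (suc zero) + (withHead (suc (suc zero))
    + sum (map withHead (tabulate (λ v → suc (suc (suc v)))))))
    ≡⟨ cong₂ _+_ (countAvoiding-prepend-low (suc n) (s≤s z≤n))
         (cong₂ _+_ (countAvoiding-prepend-low (suc n) (s≤s (s≤s z≤n)))
           (cong₂ _+_ (countAvoiding-prepend-two n)
             (sum-map-tabulate-≡0 withHead (λ v → suc (suc (suc v)))
               (countAvoiding-prepend-three n)))) ⟩
  a (suc (suc n)) + (a (suc (suc n)) + ((a (suc n) + a (suc n)) + 0))
    ≡⟨ rearrange (a (suc (suc n))) (a (suc n)) ⟩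
  2 * (a (suc (suc n)) + a (suc n))
    ∎
  where
  open ≡-Reasoning
  withHead : Fin (suc (suc (suc n))) → ℕ
  withHead v = countAvoiding (prepend v)
  rearrange : ∀ x y → x + (x + ((y + y) + 0)) ≡ 2 * (x + y)
  rearrange = solve-∀

sumTo-vanishing : ∀ d k (f : ℕ → ℤ) → (∀ j → f (suc (d + j)) ≡ 0ℤ) →
  sumTo (d + k) f ≡ sumTo d f
sumTo-vanishing d zero    f f≡0 rewrite ℕₚ.+-identityʳ d = refl
sumTo-vanishing d (suc k) f f≡0 rewrite ℕₚ.+-suc d k = begin
  sumTo (d + k) f ℤ.+ f (suc (d + k)) ≡⟨ cong (λ z → sumTo (d + k) f ℤ.+ z) (f≡0 k) ⟩
  sumTo (d + k) f ℤ.+ 0ℤ              ≡⟨ ℤₚ.+-identityʳ (sumTo (d + k) f) ⟩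
  sumTo (d + k) f                     ≡⟨ sumTo-vanishing d k f f≡0 ⟩
  sumTo d f                           ∎
  where open ≡-Reasoning

recurrence⇒series : (b : ℕ → ℕ) →
  (∀ n → b (suc (suc (suc n))) ≡ 2 * (b (suc (suc n)) + b (suc n))) →
  ∀ k → (poly (+ 1 ∷ - (+ 2) ∷ - (+ 2) ∷ []) ⊛ (λ n → + b n)) (suc (suc (suc k))) ≡ 0ℤ
recurrence⇒series b rec k = begin
  sumTo (2 + suc k) (λ i → poly c i ℤ.* B (suc (suc (suc k)) ∸ i))
    ≡⟨ sumTo-vanishing 2 (suc k) _ (λ _ → refl) ⟩
  (+ 1 ℤ.* B (suc (suc (suc k))) ℤ.+ - (+ 2) ℤ.* B (suc (suc k))) ℤ.+ - (+ 2) ℤ.* B (suc k)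
    ≡⟨ cong (λ x → (+ 1 ℤ.* x ℤ.+ - (+ 2) ℤ.* B (suc (suc k))) ℤ.+ - (+ 2) ℤ.* B (suc k))
            rec-ℤ ⟩
  (+ 1 ℤ.* (+ 2 ℤ.* (B (suc (suc k)) ℤ.+ B (suc k))) ℤ.+ - (+ 2) ℤ.* B (suc (suc k)))
    ℤ.+ - (+ 2) ℤ.* B (suc k)
    ≡⟨ cancel (B (suc (suc k))) (B (suc k)) ⟩
  0ℤ
    ∎
  where
  open ≡-Reasoning
  c : List ℤ
  c = + 1 ∷ - (+ 2) ∷ - (+ 2) ∷ []
  B : ℕ → ℤ
  B n = + b n
  rec-ℤ : B (suc (suc (suc k))) ≡ + 2 ℤ.* (B (suc (suc k)) ℤ.+ B (suc k))
  rec-ℤ = begin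
    + b (suc (suc (suc k)))
      ≡⟨ cong +_ (rec k) ⟩
    + (2 * (b (suc (suc k)) + b (suc k)))
      ≡⟨ ℤₚ.pos-* 2 (b (suc (suc k)) + b (suc k)) ⟩
    + 2 ℤ.* + (b (suc (suc k)) + b (suc k))
      ≡⟨ cong (+ 2 ℤ.*_) (ℤₚ.pos-+ (b (suc (suc k))) (b (suc k))) ⟩
    + 2 ℤ.* (B (suc (suc k)) ℤ.+ B (suc k))
      ∎
  cancel : ∀ x y → (+ 1 ℤ.* (+ 2 ℤ.* (x ℤ.+ y)) ℤ.+ - (+ 2) ℤ.* x) ℤ.+ - (+ 2) ℤ.* y ≡ 0ℤ
  cancel = ℤ-solve-∀

generating-function : ∀ n → (poly (+ 1 ∷ - (+ 2) ∷ - (+ 2) ∷ []) ⊛ genA) n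
                             ≡ poly (+ 1 ∷ - (+ 1) ∷ - (+ 2) ∷ []) n
generating-function 0                   = refl
generating-function 1                   = refl
generating-function 2                   = refl
generating-function (suc (suc (suc k))) = recurrence⇒series a a-recurrence k

theorem19 : (a 0 ≡ 1) × (a 1 ≡ 1) × (a 2 ≡ 2)
            × ((n : ℕ) → a (suc (suc (suc n))) ≡ 2 * (a (suc (suc n)) + a (suc n)))
            × ((n : ℕ) → (poly (+ 1 ∷ - (+ 2) ∷ - (+ 2) ∷ []) ⊛ genA) n
                           ≡ poly (+ 1 ∷ - (+ 1) ∷ - (+ 2) ∷ []) n)
theorem19 = refl , refl , refl , a-recurrence , generating-function
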